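{- Let $m,n$ be positive integers, $A=\{(i,j)\in\mathbb{Z}^2: 0\le i<m,\ 0\le j<n\}$, let $S$ be a valid set of directions for $A$, and suppose prescribed line sums along all lines with directions in $S$ are given which are the line sums of some function $A\to\mathbb{R}$. Let $f_0$ be the projection function for these line sums, let $D$ be the sum of the prescribed line sums in any one direction of $S$, let $\langle x\rangle=\min(|x|,|1-x|)$ and $E=\sum_{(i,j)\in A}\langle f_0(i,j)\rangle^2$. Let $F:A\to\{0,1\}$ be obtained by rounding each $f_0(i,j)$ to an element of $\{0,1\}$ nearest to it. Let $b_1\le b_2\le\dots\le b_{mn}$ be the values $|2f_0(i,j)-1|$, $(i,j)\in A$, in nondecreasing order. Let $s$ be the integer with $b_1+\dots+b_s\le D-E-|\vec{f_0}|^2<b_1+\dots+b_{s+1}$, and $t$ the integer with $b_1+\dots+b_t\le 2(D-E-|\vec{f_0}|^2)<b_1+\dots+b_{t+1}$. Then: (a) every function $g:A\to\{0,1\}$ with the prescribed line sums satisfies $g(i,j)=F(i,j)$ for at least $mn-s$ elements $(i,j)\in A$; (b) any two functions $g_1,g_2:A\to\{0,1\}$ with the prescribed line sums satisfy $g_1(i,j)=g_2(i,j)$ for at least $mn-t$ elements $(i,j)\in A$.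
   Context: A direction is a pair $(a,b)\in\mathbb{Z}^2$ with $\gcd(a,b)=1$ and $a\ge 0$, where $(a,b)=(0,1)$ if $a=0$. The lines with direction $(a,b)$ are the lines $ay=bx+t$ ($t\in\mathbb{Z}$); the line sum of $g:A\to\mathbb{R}$ along $ay=bx+t$ is $\sum g(i,j)$ over all $(i,j)\in A$ with $aj=bi+t$. A finite set $S=\{(a_d,b_d)\}_{d=1}^k$ of distinct directions is valid for $A$ if $\sum_d a_d<m$ and $\sum_d |b_d|<n$. Functions $A\to\mathbb{R}$ are identified with vectors in $\mathbb{R}^{mn}$ with Euclidean norm $|\vec v|=\sqrt{\sum_{(i,j)\in A}v(i,j)^2}$. The projection function $f_0$ for the given line sums is the unique function $A\to\mathbb{R}$ having these line sums whose vector is orthogonal to the vector of every function $A\to\mathbb{R}$ with all line sums (in the directions of $S$) equal to $0$. Empty sums are $0$.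
   Formalization: The function whose line sums are prescribed, the projection function $f_0$ and the functions with all line sums 0 tested in its definition take values in ℚ instead of ℝ. -}

module Defs where

open import Data.Nat as ℕ using (ℕ; zero; suc)
open import Data.Integer as ℤ using (ℤ; +_)
open import Data.Integer.GCD using () renaming (gcd to gcdℤ)
open import Data.Rational as ℚ using (ℚ; 0ℚ; 1ℚ; _+_; _*_; _-_; ∣_∣; _⊓_; _≤_; _<_)
open import Data.Rational.Properties using (≤-decTotalOrder)
open import Data.Fin using (Fin)
open import Data.List using (List; []; _∷_; foldr; map; concatMap; allFin; filter; length; take; upTo)
open import Data.List.Membership.Propositional using (_∈_)
open import Data.List.Relation.Unary.Unique.Propositional using (Unique)
open import Data.Product using (_×_; _,_; proj₁; proj₂; Σ)
open import Data.Bool using (Bool; true; false; if_then_else_)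
open import Relation.Binary.PropositionalEquality using (_≡_)
open import Relation.Nullary.Decidable using (⌊_⌋)
open import Data.Empty using (⊥)
open import Data.Sum using (_⊎_)
open import Data.List.Sort ≤-decTotalOrder using (sort)

Direction : Set
Direction = ℕ × ℤ

IsDirection : Direction → Set
IsDirection (a , b) = (gcdℤ (+ a) b ≡ ℤ.+ 1) × (a ≡ 0 → b ≡ ℤ.+ 1)

sumℕ : List ℕ → ℕ
sumℕ = foldr ℕ._+_ 0

ValidDirs : ℕ → ℕ → List Direction → Set
ValidDirs m n S =
  ((d : Direction) → d ∈ S → IsDirection d)
  × Unique S
  × (sumℕ (map proj₁ S) ℕ.< m)
  × (sumℕ (map (λ d → ℤ.∣ proj₂ d ∣) S) ℕ.< n)

Fun : ℕ → ℕ → Set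
Fun m n = Fin m → Fin n → ℚ

sumℚ : List ℚ → ℚ
sumℚ = foldr _+_ 0ℚ

cells : (m n : ℕ) → List (Fin m × Fin n)
cells m n = concatMap (λ i → map (λ j → (i , j)) (allFin n)) (allFin m)

sumA : {m n : ℕ} → Fun m n → ℚ
sumA {m} {n} f = sumℚ (map (λ c → f (proj₁ c) (proj₂ c)) (cells m n))

toℤ : {k : ℕ} → Fin k → ℤ
toℤ i = + (Data.Fin.toℕ i)

onLine : {m n : ℕ} → Direction → ℤ → Fin m → Fin n → Bool
onLine (a , b) t i j = ⌊ (+ a) ℤ.* toℤ j ℤ.≟ b ℤ.* toℤ i ℤ.+ t ⌋

lineSum : {m n : ℕ} → Fun m n → Direction → ℤ → ℚ
lineSum f d t = sumA (λ i j → if onLine d t i j then f i j else 0ℚ)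

SameLineSums : {m n : ℕ} → List Direction → Fun m n → Fun m n → Set
SameLineSums S f h = (d : Direction) → d ∈ S → (t : ℤ) → lineSum f d t ≡ lineSum h d t

ZeroLineSums : {m n : ℕ} → List Direction → Fun m n → Set
ZeroLineSums S f = (d : Direction) → d ∈ S → (t : ℤ) → lineSum f d t ≡ 0ℚ

dot : {m n : ℕ} → Fun m n → Fun m n → ℚ
dot f g = sumA (λ i j → f i j * g i j)

normSq : {m n : ℕ} → Fun m n → ℚ
normSq f = dot f f

IsProjection : {m n : ℕ} → List Direction → Fun m n → Fun m n → Set
IsProjection S h f₀ =
  SameLineSums S f₀ h × ((g : Fun _ _) → ZeroLineSums S g → dot f₀ g ≡ 0ℚ)

-- the bound K such that every line a y = b x + t meeting A has |t| ≤ K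
lineBound : ℕ → ℕ → Direction → ℕ
lineBound m n (a , b) = a ℕ.* n ℕ.+ ℤ.∣ b ∣ ℕ.* m

intRange : ℕ → List ℤ
intRange K = map (λ k → + k ℤ.- + K) (upTo (suc (2 ℕ.* K)))

-- D: sum of the prescribed line sums (those of h) in direction d;
-- lines with |t| > lineBound do not meet A and contribute empty sums 0.
lineSumTotal : {m n : ℕ} → Fun m n → Direction → ℚ
lineSumTotal {m} {n} h d = sumℚ (map (lineSum h d) (intRange (lineBound m n d)))

⟨_⟩ : ℚ → ℚ
⟨ x ⟩ = ∣ x ∣ ⊓ ∣ 1ℚ - x ∣

Equant : {m n : ℕ} → Fun m n → ℚ
Equant f = sumA (λ i j → ⟨ f i j ⟩ * ⟨ f i j ⟩)

B01 : ℕ → ℕ → Set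
B01 m n = Fin m → Fin n → Bool

bval : Bool → ℚ
bval true  = 1ℚ
bval false = 0ℚ

asFun : {m n : ℕ} → B01 m n → Fun m n
asFun g i j = bval (g i j)

IsRounding : {m n : ℕ} → Fun m n → B01 m n → Set
IsRounding f F = ∀ i j → (c : Bool) → ∣ f i j - bval (F i j) ∣ ≤ ∣ f i j - bval c ∣

twoℚ : ℚ
twoℚ = 1ℚ + 1ℚ

bList : {m n : ℕ} → Fun m n → List ℚ
bList {m} {n} f =
  sort (map (λ c → ∣ twoℚ * f (proj₁ c) (proj₂ c) - 1ℚ ∣) (cells m n))

prefixSum : List ℚ → ℕ → ℚ
prefixSum bs k = sumℚ (take k bs)

-- s is "the integer with b₁+…+b_s ≤ X < b₁+…+b_{s+1}", where
-- b₁+…+b_{mn+1} is read as +∞ (so s = mn when X ≥ b₁+…+b_{mn}).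
IsCutoff : List ℚ → ℚ → ℕ → Set
IsCutoff bs X s =
  (s ℕ.≤ length bs) × (prefixSum bs s ≤ X) × (s ℕ.< length bs → X < prefixSum bs (suc s))

agreements : {m n : ℕ} → B01 m n → B01 m n → ℕ
agreements {m} {n} g F =
  length (filter (λ c → Data.Bool._≟_ (g (proj₁ c) (proj₂ c)) (F (proj₁ c) (proj₂ c))) (cells m n))

module Submission where

-- If a 0/1 function g has the prescribed line sums, then g − f₀ has zero line
-- sums, so f₀ · g = |f₀|² and |f₀ − g|² = |g|² − |f₀|² = D − |f₀|² (since g² = g
-- and the lines of one direction partition A). Cell by cell, (f₀ − g)² equals
-- ⟨f₀⟩² plus |2f₀ − 1| exactly where g differs from the rounding F, so the values b
-- of the cells where g ≠ F add up to D − E − |f₀|². Since any k of the b's sum to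
-- at least b₁ + ⋯ + b_k, there are at most s such cells. Two solutions g₁, g₂
-- differ only where one of them differs from F, whence the bound 2(D − E − |f₀|²)
-- and t.

open import Defs

module RationalSums where

  open import Data.Bool using (Bool; true; false; if_then_else_)
  open import Data.Bool.Properties using (¬-not)
  open import Data.List using (List; []; _∷_; map; filter)
  open import Data.List.Membership.Propositional using (_∈_)
  open import Data.List.Relation.Unary.All as All using (All; []; _∷_)
  open import Data.List.Relation.Unary.AllPairs using (_∷_)
  open import Data.List.Relation.Unary.Any using (here; there)
  open import Data.List.Relation.Unary.Unique.Propositional using (Unique)
  open import Data.List.Relation.Binary.Permutation.Propositional using (_↭_; ↭⇒↭ₛ)
  open import Data.Rational using (ℚ; 0ℚ; _+_; _*_; _-_; _≤_)
  import Data.Rational.Properties as ℚP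
  open import Data.Rational.Solver using (module +-*-Solver)
  open +-*-Solver
  open import Function using (_∘_)
  open import Relation.Binary.PropositionalEquality
  open import Data.List.Relation.Binary.Permutation.Setoid.Properties (setoid ℚ)
    using (foldr-commMonoid)
  open import Relation.Nullary using (does)
  open import Relation.Unary using (Decidable)
  open import Relation.Unary.Properties using (∁?)

  sumℚ-↭ : {xs ys : List ℚ} → xs ↭ ys → sumℚ xs ≡ sumℚ ys
  sumℚ-↭ p = foldr-commMonoid ℚP.+-0-isCommutativeMonoid (↭⇒↭ₛ p)

  sumℚ-nonNeg : {xs : List ℚ} → All (0ℚ ≤_) xs → 0ℚ ≤ sumℚ xs
  sumℚ-nonNeg []       = ℚP.≤-refl
  sumℚ-nonNeg (p ∷ ps) = ℚP.+-mono-≤ p (sumℚ-nonNeg ps)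

  module _ {A : Set} where

    sumℚ-map-cong : {f g : A → ℚ} → (∀ x → f x ≡ g x) → (xs : List A) →
      sumℚ (map f xs) ≡ sumℚ (map g xs)
    sumℚ-map-cong f≗g []       = refl
    sumℚ-map-cong f≗g (x ∷ xs) = cong₂ _+_ (f≗g x) (sumℚ-map-cong f≗g xs)

    sumℚ-map-mono : {f g : A → ℚ} → (∀ x → f x ≤ g x) → (xs : List A) →
      sumℚ (map f xs) ≤ sumℚ (map g xs)
    sumℚ-map-mono f≤g []       = ℚP.≤-refl
    sumℚ-map-mono f≤g (x ∷ xs) = ℚP.+-mono-≤ (f≤g x) (sumℚ-map-mono f≤g xs)

    sumℚ-map-zero : {f : A → ℚ} {xs : List A} → All (λ x → f x ≡ 0ℚ) xs → sumℚ (map f xs) ≡ 0ℚ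
    sumℚ-map-zero []             = refl
    sumℚ-map-zero (fx≡0 ∷ fxs≡0) = trans (cong₂ _+_ fx≡0 (sumℚ-map-zero fxs≡0)) (ℚP.+-identityˡ 0ℚ)

    sumℚ-map-+ : (f g : A → ℚ) (xs : List A) →
      sumℚ (map (λ x → f x + g x) xs) ≡ sumℚ (map f xs) + sumℚ (map g xs)
    sumℚ-map-+ f g []       = refl
    sumℚ-map-+ f g (x ∷ xs) = trans (cong (f x + g x +_) (sumℚ-map-+ f g xs))
      (solve 4 (λ a b c d → (a :+ b) :+ (c :+ d) := (a :+ c) :+ (b :+ d))
        refl (f x) (g x) (sumℚ (map f xs)) (sumℚ (map g xs)))

    sumℚ-map-- : (f g : A → ℚ) (xs : List A) →
      sumℚ (map (λ x → f x - g x) xs) ≡ sumℚ (map f xs) - sumℚ (map g xs)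
    sumℚ-map-- f g []       = refl
    sumℚ-map-- f g (x ∷ xs) = trans (cong (f x - g x +_) (sumℚ-map-- f g xs))
      (solve 4 (λ a b c d → (a :- b) :+ (c :- d) := (a :+ c) :- (b :+ d))
        refl (f x) (g x) (sumℚ (map f xs)) (sumℚ (map g xs)))

    sumℚ-map-*ˡ : (k : ℚ) (f : A → ℚ) (xs : List A) →
      sumℚ (map (λ x → k * f x) xs) ≡ k * sumℚ (map f xs)
    sumℚ-map-*ˡ k f []       = sym (ℚP.*-zeroʳ k)
    sumℚ-map-*ˡ k f (x ∷ xs) = trans (cong (k * f x +_) (sumℚ-map-*ˡ k f xs))
      (sym (ℚP.*-distribˡ-+ k (f x) _))

    sumℚ-map-filter-∁ : {P : A → Set} (P? : Decidable P) (f : A → ℚ) (xs : List A) →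
      sumℚ (map f (filter (∁? P?) xs)) ≡ sumℚ (map (λ x → if does (P? x) then 0ℚ else f x) xs)
    sumℚ-map-filter-∁ P? f []       = refl
    sumℚ-map-filter-∁ P? f (x ∷ xs) with does (P? x)
    ... | true  = trans (sumℚ-map-filter-∁ P? f xs) (sym (ℚP.+-identityˡ _))
    ... | false = cong (f x +_) (sumℚ-map-filter-∁ P? f xs)

    module _ (P : A → Bool) (v : ℚ) {x₀ : A} (only : ∀ x → P x ≡ true → x ≡ x₀) where

      private
        indicator-off : ∀ {x} → x ≢ x₀ → (if P x then v else 0ℚ) ≡ 0ℚ
        indicator-off x≢x₀ = cong (if_then v else 0ℚ) (¬-not (x≢x₀ ∘ only _))

      sumℚ-map-indicator-unique : {xs : List A} → Unique xs → x₀ ∈ xs → P x₀ ≡ true →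
        sumℚ (map (λ x → if P x then v else 0ℚ) xs) ≡ v
      sumℚ-map-indicator-unique (x₀∉xs ∷ _) (here refl) Px₀ = trans
        (cong₂ _+_ (cong (if_then v else 0ℚ) Px₀)
                   (sumℚ-map-zero (All.map (λ x₀≢x → indicator-off (x₀≢x ∘ sym)) x₀∉xs)))
        (ℚP.+-identityʳ v)
      sumℚ-map-indicator-unique (x∉xs ∷ u) (there x₀∈xs) Px₀ = trans
        (cong₂ _+_ (indicator-off (All.lookup x∉xs x₀∈xs))
                   (sumℚ-map-indicator-unique u x₀∈xs Px₀))
        (ℚP.+-identityˡ v)

  sumℚ-map-swap : {A B : Set} (f : A → B → ℚ) (xs : List A) (ys : List B) →
    sumℚ (map (λ x → sumℚ (map (f x) ys)) xs) ≡ sumℚ (map (λ y → sumℚ (map (λ x → f x y) xs)) ys)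
  sumℚ-map-swap f []       ys = sym (sumℚ-map-zero (All.universal (λ _ → refl) ys))
  sumℚ-map-swap f (x ∷ xs) ys = trans (cong (sumℚ (map (f x) ys) +_) (sumℚ-map-swap f xs ys))
    (sym (sumℚ-map-+ (f x) (λ y → sumℚ (map (λ x′ → f x′ y) xs)) ys))

module Lines where

  open RationalSums
  open import Data.Bool using (true; if_then_else_)
  open import Data.Fin using (Fin)
  import Data.Fin.Properties as FinP
  open import Data.Integer as ℤ using (ℤ; +_; -[1+_])
  import Data.Integer.Properties as ℤP
  open import Data.Integer.Tactic.RingSolver using (solve-∀)
  open import Data.List using (List; map)
  open import Data.List.Membership.Propositional using (_∈_)
  open import Data.List.Membership.Propositional.Properties using (∈-map⁺; ∈-upTo⁺)
  open import Data.List.Relation.Unary.Unique.Propositional using (Unique)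
  import Data.List.Relation.Unary.Unique.Propositional.Properties as Unique
  open import Data.Nat as ℕ using (ℕ; suc; _≤_; s≤s)
  import Data.Nat.Properties as ℕP
  open import Data.Product using (_,_; proj₁; proj₂; uncurry)
  open import Data.Rational using (0ℚ)
  open import Relation.Nullary using (yes)
  open import Relation.Nullary.Decidable using (dec-true; isYes≗does)
  open import Relation.Binary.PropositionalEquality

  intercept : {m n : ℕ} → Direction → Fin m → Fin n → ℤ
  intercept (a , b) i j = + a ℤ.* toℤ j ℤ.- b ℤ.* toℤ i

  onLine-intercept : {m n : ℕ} (d : Direction) (i : Fin m) (j : Fin n) →
    onLine d (intercept d i j) i j ≡ true
  onLine-intercept (a , b) i j =
    trans (isYes≗does (_ ℤ.≟ _)) (dec-true (_ ℤ.≟ _) (x≡y+[x-y] (+ a ℤ.* toℤ j) (b ℤ.* toℤ i)))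
    where
    x≡y+[x-y] : ∀ x y → x ≡ y ℤ.+ (x ℤ.- y)
    x≡y+[x-y] = solve-∀

  onLine⇒≡intercept : {m n : ℕ} (d : Direction) (t : ℤ) (i : Fin m) (j : Fin n) →
    onLine d t i j ≡ true → t ≡ intercept d i j
  onLine⇒≡intercept (a , b) t i j _ with + a ℤ.* toℤ j ℤ.≟ b ℤ.* toℤ i ℤ.+ t
  ... | yes aj≡bi+t = trans (t≡[y+t]-y (b ℤ.* toℤ i) t) (cong (ℤ._- b ℤ.* toℤ i) (sym aj≡bi+t))
    where
    t≡[y+t]-y : ∀ y t → t ≡ (y ℤ.+ t) ℤ.- y
    t≡[y+t]-y = solve-∀

  ∣intercept∣≤lineBound : {m n : ℕ} (d : Direction) (i : Fin m) (j : Fin n) →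
    ℤ.∣ intercept d i j ∣ ≤ lineBound m n d
  ∣intercept∣≤lineBound {m} {n} (a , b) i j = ℕP.≤-trans
    (ℤP.∣i-j∣≤∣i∣+∣j∣ (+ a ℤ.* toℤ j) (b ℤ.* toℤ i))
    (ℕP.+-mono-≤
      (ℕP.≤-trans (ℕP.≤-reflexive (ℤP.abs-* (+ a) (toℤ j))) (ℕP.*-monoʳ-≤ a (FinP.toℕ≤n j)))
      (ℕP.≤-trans (ℕP.≤-reflexive (ℤP.abs-* b (toℤ i))) (ℕP.*-monoʳ-≤ ℤ.∣ b ∣ (FinP.toℕ≤n i))))

  ∈-intRange : ∀ K {t} → ℤ.∣ t ∣ ≤ K → t ∈ intRange K
  ∈-intRange K {t = + p} p≤K = subst (_∈ intRange K) ([x+y]-y≡x (+ p) (+ K))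
    (∈-map⁺ (λ k → + k ℤ.- + K) (∈-upTo⁺ (s≤s p+K≤2K)))
    where
    [x+y]-y≡x : ∀ x y → (x ℤ.+ y) ℤ.- y ≡ x
    [x+y]-y≡x = solve-∀
    p+K≤2K : p ℕ.+ K ≤ 2 ℕ.* K
    p+K≤2K = subst (p ℕ.+ K ≤_) (cong (K ℕ.+_) (sym (ℕP.+-identityʳ K))) (ℕP.+-monoˡ-≤ K p≤K)
  ∈-intRange K {t = -[1+ p ]} 1+p≤K with ℕP.m≤n⇒∃[o]m+o≡n 1+p≤K
  ... | r , refl = subst (_∈ intRange K) (y-[x+y]≡-x (+ suc p) (+ r))
    (∈-map⁺ (λ k → + k ℤ.- + K) (∈-upTo⁺ (s≤s r≤2K)))
    where
    y-[x+y]≡-x : ∀ x y → y ℤ.- (x ℤ.+ y) ≡ ℤ.- x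
    y-[x+y]≡-x = solve-∀
    r≤2K : r ≤ 2 ℕ.* K
    r≤2K = ℕP.≤-trans (ℕP.m≤n+m r (suc p)) (ℕP.m≤m+n K (K ℕ.+ 0))

  intRange-unique : ∀ K → Unique (intRange K)
  intRange-unique K = Unique.map⁺ -K-injective (Unique.upTo⁺ (suc (2 ℕ.* K)))
    where
    [x-y]+y≡x : ∀ x y → (x ℤ.- y) ℤ.+ y ≡ x
    [x-y]+y≡x = solve-∀
    -K-injective : ∀ {x y} → + x ℤ.- + K ≡ + y ℤ.- + K → x ≡ y
    -K-injective {x} {y} eq = ℤP.+-injective
      (trans (sym ([x-y]+y≡x (+ x) (+ K))) (trans (cong (ℤ._+ + K) eq) ([x-y]+y≡x (+ y) (+ K))))

  sumℚ-lineSums≡sumA : {m n : ℕ} (f : Fun m n) (d : Direction) →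
    sumℚ (map (lineSum f d) (intRange (lineBound m n d))) ≡ sumA f
  sumℚ-lineSums≡sumA {m} {n} f d = trans
    (sumℚ-map-swap (λ t c → if onLine d t (proj₁ c) (proj₂ c) then uncurry f c else 0ℚ) ts (cells m n))
    (sumℚ-map-cong onOneLine (cells m n))
    where
    ts : List ℤ
    ts = intRange (lineBound m n d)
    onOneLine : ∀ c → sumℚ (map (λ t → if onLine d t (proj₁ c) (proj₂ c) then uncurry f c else 0ℚ) ts)
                      ≡ uncurry f c
    onOneLine (i , j) = sumℚ-map-indicator-unique (λ t → onLine d t i j) (f i j)
      (λ t → onLine⇒≡intercept d t i j) (intRange-unique (lineBound m n d))
      (∈-intRange (lineBound m n d) (∣intercept∣≤lineBound d i j)) (onLine-intercept d i j)

  sumA≡lineSumTotal : {m n : ℕ} (f h : Fun m n) (d : Direction) →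
    (∀ t → lineSum f d t ≡ lineSum h d t) → sumA f ≡ lineSumTotal h d
  sumA≡lineSumTotal {m} {n} f h d f~h =
    trans (sym (sumℚ-lineSums≡sumA f d)) (sumℚ-map-cong f~h (intRange (lineBound m n d)))

module Projection where

  open RationalSums
  open Lines
  open import Data.Bool using (true; false; if_then_else_)
  open import Data.Fin using (Fin)
  open import Data.Integer using (ℤ)
  open import Data.List using (List; map)
  open import Data.Nat using (ℕ)
  open import Data.Product using (_×_; _,_; proj₁; proj₂; uncurry)
  open import Data.Rational using (ℚ; 0ℚ; 1ℚ; _+_; _*_; _-_)
  import Data.Rational.Properties as ℚP
  open import Data.Rational.Solver using (module +-*-Solver)
  open +-*-Solver
  open import Relation.Binary.PropositionalEquality
  open ≡-Reasoning

  infixl 6 _-ᶠ_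

  _-ᶠ_ : {m n : ℕ} → Fun m n → Fun m n → Fun m n
  (f -ᶠ g) i j = f i j - g i j

  sumA-cong : {m n : ℕ} {f g : Fun m n} → (∀ i j → f i j ≡ g i j) → sumA f ≡ sumA g
  sumA-cong {m} {n} f≗g = sumℚ-map-cong (λ (i , j) → f≗g i j) (cells m n)

  sumA-- : {m n : ℕ} (f g : Fun m n) → sumA (f -ᶠ g) ≡ sumA f - sumA g
  sumA-- {m} {n} f g = sumℚ-map-- (uncurry f) (uncurry g) (cells m n)

  lineSum-- : {m n : ℕ} (f g : Fun m n) (d : Direction) (t : ℤ) →
    lineSum (f -ᶠ g) d t ≡ lineSum f d t - lineSum g d t
  lineSum-- {m} {n} f g d t = trans (sumA-cong {m} {n} (λ i j → if-distrib-- (onLine d t i j)))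
    (sumA-- {m} {n} (λ i j → if onLine d t i j then f i j else 0ℚ)
                    (λ i j → if onLine d t i j then g i j else 0ℚ))
    where
    if-distrib-- : ∀ b {x y} → (if b then x - y else 0ℚ) ≡ (if b then x else 0ℚ) - (if b then y else 0ℚ)
    if-distrib-- true  = refl
    if-distrib-- false = refl

  zeroLineSums-diff : {m n : ℕ} (S : List Direction) {f g h : Fun m n} →
    SameLineSums S f h → SameLineSums S g h → ZeroLineSums S (f -ᶠ g)
  zeroLineSums-diff S {f} {g} {h} f~h g~h d d∈S t = begin
    lineSum (f -ᶠ g) d t            ≡⟨ lineSum-- f g d t ⟩
    lineSum f d t - lineSum g d t   ≡⟨ cong₂ _-_ (f~h d d∈S t) (g~h d d∈S t) ⟩
    lineSum h d t - lineSum h d t   ≡⟨ ℚP.+-inverseʳ (lineSum h d t) ⟩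
    0ℚ                              ∎

  module _ {m n : ℕ} {S : List Direction} {h f₀ : Fun m n} (proj : IsProjection S h f₀)
           {f : Fun m n} (f~h : SameLineSums S f h) where

    dot-projection : dot f₀ f ≡ normSq f₀
    dot-projection = begin
      dot f₀ f                            ≡⟨ solve 2 (λ p q → p := (p :- q) :+ q) refl (dot f₀ f) (normSq f₀) ⟩
      (dot f₀ f - normSq f₀) + normSq f₀  ≡⟨ cong (_+ normSq f₀) (sym dot-diff) ⟩
      dot f₀ (f -ᶠ f₀) + normSq f₀        ≡⟨ cong (_+ normSq f₀) (proj₂ proj (f -ᶠ f₀) f-f₀-zero) ⟩
      0ℚ + normSq f₀                      ≡⟨ ℚP.+-identityˡ (normSq f₀) ⟩
      normSq f₀                           ∎
      where
      f-f₀-zero : ZeroLineSums S (f -ᶠ f₀)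
      f-f₀-zero = zeroLineSums-diff S {f} {f₀} f~h (proj₁ proj)
      dot-diff : dot f₀ (f -ᶠ f₀) ≡ dot f₀ f - normSq f₀
      dot-diff = trans
        (sumA-cong {m} {n} λ i j →
          solve 3 (λ x y z → x :* (y :- z) := x :* y :- x :* z) refl (f₀ i j) (f i j) (f₀ i j))
        (sumA-- (λ i j → f₀ i j * f i j) (λ i j → f₀ i j * f₀ i j))

    pythagoras : normSq (f₀ -ᶠ f) ≡ normSq f - normSq f₀
    pythagoras = begin
      normSq (f₀ -ᶠ f)
        ≡⟨ sumℚ-map-cong (λ c → expand (x c) (y c)) cs ⟩
      sumℚ (map (λ c → (y c * y c - twoℚ * (x c * y c)) + x c * x c) cs)
        ≡⟨ sumℚ-map-+ (λ c → y c * y c - twoℚ * (x c * y c)) (λ c → x c * x c) cs ⟩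
      sumℚ (map (λ c → y c * y c - twoℚ * (x c * y c)) cs) + normSq f₀
        ≡⟨ cong (_+ normSq f₀) (sumℚ-map-- (λ c → y c * y c) (λ c → twoℚ * (x c * y c)) cs) ⟩
      (normSq f - sumℚ (map (λ c → twoℚ * (x c * y c)) cs)) + normSq f₀
        ≡⟨ cong (λ z → (normSq f - z) + normSq f₀) (sumℚ-map-*ˡ twoℚ (λ c → x c * y c) cs) ⟩
      (normSq f - twoℚ * dot f₀ f) + normSq f₀
        ≡⟨ cong (λ z → (normSq f - twoℚ * z) + normSq f₀) dot-projection ⟩
      (normSq f - twoℚ * normSq f₀) + normSq f₀
        ≡⟨ solve 2 (λ p q → (p :- (con 1ℚ :+ con 1ℚ) :* q) :+ q := p :- q)
                   refl (normSq f) (normSq f₀) ⟩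
      normSq f - normSq f₀
        ∎
      where
      cs : List (Fin m × Fin n)
      cs = cells m n
      x y : Fin m × Fin n → ℚ
      x = uncurry f₀
      y = uncurry f
      expand : ∀ x y → (x - y) * (x - y) ≡ (y * y - twoℚ * (x * y)) + x * x
      expand = solve 2 (λ x y → (x :- y) :* (x :- y)
                             := (y :* y :- (con 1ℚ :+ con 1ℚ) :* (x :* y)) :+ x :* x) refl

module Mismatch where

  open RationalSums
  open import Data.Bool using (Bool; true; false; if_then_else_)
  open import Data.Bool.Properties using () renaming (_≟_ to _≟ᵇ_)
  open import Data.List using (List; map; filter)
  open import Data.Rational using (ℚ; 0ℚ; _+_; _≤_)
  import Data.Rational.Properties as ℚP
  open import Relation.Nullary using (does)
  open import Relation.Unary using (Decidable)
  open import Relation.Unary.Properties using (∁?)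
  open import Relation.Binary.PropositionalEquality

  mismatch : Bool → Bool → ℚ → ℚ
  mismatch g c r = if does (g ≟ᵇ c) then 0ℚ else r

  mismatch-triangle : ∀ g₁ g₂ c {r} → 0ℚ ≤ r → mismatch g₁ g₂ r ≤ mismatch g₁ c r + mismatch g₂ c r
  mismatch-triangle true  true  true  0≤r = ℚP.≤-refl
  mismatch-triangle true  true  false 0≤r = ℚP.+-mono-≤ 0≤r 0≤r
  mismatch-triangle true  false true  0≤r = ℚP.≤-reflexive (sym (ℚP.+-identityˡ _))
  mismatch-triangle true  false false 0≤r = ℚP.≤-reflexive (sym (ℚP.+-identityʳ _))
  mismatch-triangle false true  true  0≤r = ℚP.≤-reflexive (sym (ℚP.+-identityʳ _))
  mismatch-triangle false true  false 0≤r = ℚP.≤-reflexive (sym (ℚP.+-identityˡ _))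
  mismatch-triangle false false true  0≤r = ℚP.+-mono-≤ 0≤r 0≤r
  mismatch-triangle false false false 0≤r = ℚP.≤-refl

  agree? : {C : Set} (g g′ : C → Bool) → Decidable (λ c → g c ≡ g′ c)
  agree? g g′ c = g c ≟ᵇ g′ c

  module _ {C : Set} (b : C → ℚ) where

    disagreementWeight : (g g′ : C → Bool) → List C → ℚ
    disagreementWeight g g′ cs = sumℚ (map b (filter (∁? (agree? g g′)) cs))

    disagreementWeight≡sum-mismatch : ∀ g g′ cs →
      disagreementWeight g g′ cs ≡ sumℚ (map (λ c → mismatch (g c) (g′ c) (b c)) cs)
    disagreementWeight≡sum-mismatch g g′ = sumℚ-map-filter-∁ (agree? g g′) b

    disagreementWeight-triangle : (∀ c → 0ℚ ≤ b c) → ∀ g₁ g₂ g cs →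
      disagreementWeight g₁ g₂ cs ≤ disagreementWeight g₁ g cs + disagreementWeight g₂ g cs
    disagreementWeight-triangle 0≤b g₁ g₂ g cs = subst₂ _≤_
      (sym (disagreementWeight≡sum-mismatch g₁ g₂ cs))
      (trans (sumℚ-map-+ _ _ cs) (sym (cong₂ _+_ (disagreementWeight≡sum-mismatch g₁ g cs)
                                                 (disagreementWeight≡sum-mismatch g₂ g cs))))
      (sumℚ-map-mono (λ c → mismatch-triangle (g₁ c) (g₂ c) (g c) (0≤b c)) cs)

module NearestBit where

  open Mismatch
  open import Data.Bool using (Bool; true; false; not)
  open import Data.Bool.Properties using (¬-not) renaming (_≟_ to _≟ᵇ_)
  open import Data.Rational using (ℚ; 0ℚ; 1ℚ; _+_; _*_; _-_; -_; ∣_∣; _≤_)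
  import Data.Rational.Properties as ℚP
  open import Data.Rational.Solver using (module +-*-Solver)
  open +-*-Solver
  open import Data.Sum using (inj₁; inj₂)
  open import Relation.Nullary using (yes; no)
  open import Relation.Binary.PropositionalEquality
  open ≡-Reasoning

  IsNearestBit : ℚ → Bool → Set
  IsNearestBit x c = ∀ c′ → ∣ x - bval c ∣ ≤ ∣ x - bval c′ ∣

  ∣p∣*∣p∣≡p*p : ∀ p → ∣ p ∣ * ∣ p ∣ ≡ p * p
  ∣p∣*∣p∣≡p*p p with ℚP.∣p∣≡p∨∣p∣≡-p p
  ... | inj₁ ∣p∣≡p  rewrite ∣p∣≡p  = refl
  ... | inj₂ ∣p∣≡-p rewrite ∣p∣≡-p = solve 1 (λ p → (:- p) :* (:- p) := p :* p) refl p

  ∣p∣≤∣q∣⇒p*p≤q*q : ∀ {p q} → ∣ p ∣ ≤ ∣ q ∣ → p * p ≤ q * q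
  ∣p∣≤∣q∣⇒p*p≤q*q {p} {q} ∣p∣≤∣q∣ = subst₂ _≤_ (∣p∣*∣p∣≡p*p p) (∣p∣*∣p∣≡p*p q)
    (ℚP.≤-trans (ℚP.*-monoˡ-≤-nonNeg ∣ p ∣ {{ℚP.∣-∣-nonNeg p}} ∣p∣≤∣q∣)
                (ℚP.*-monoʳ-≤-nonNeg ∣ q ∣ {{ℚP.∣-∣-nonNeg q}} ∣p∣≤∣q∣))

  p≤q⇒0≤q-p : ∀ {p q} → p ≤ q → 0ℚ ≤ q - p
  p≤q⇒0≤q-p {p} {q} p≤q = subst (_≤ q - p) (ℚP.+-inverseʳ p) (ℚP.+-monoˡ-≤ (- p) p≤q)

  ∣x-0∣≡∣x∣ : ∀ x → ∣ x - 0ℚ ∣ ≡ ∣ x ∣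
  ∣x-0∣≡∣x∣ x = cong ∣_∣ (ℚP.+-identityʳ x)

  ∣1-x∣≡∣x-1∣ : ∀ x → ∣ 1ℚ - x ∣ ≡ ∣ x - 1ℚ ∣
  ∣1-x∣≡∣x-1∣ x = trans (cong ∣_∣ (solve 1 (λ x → con 1ℚ :- x := :- (x :- con 1ℚ)) refl x))
                        (ℚP.∣-p∣≡∣p∣ (x - 1ℚ))

  ⟨⟩-nearest : ∀ {x c} → IsNearestBit x c → ⟨ x ⟩ ≡ ∣ x - bval c ∣
  ⟨⟩-nearest {x} {false} nearest = trans
    (ℚP.p≤q⇒p⊓q≡p (subst₂ _≤_ (∣x-0∣≡∣x∣ x) (sym (∣1-x∣≡∣x-1∣ x)) (nearest true)))
    (sym (∣x-0∣≡∣x∣ x))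
  ⟨⟩-nearest {x} {true} nearest = trans
    (ℚP.p≥q⇒p⊓q≡q (subst₂ _≤_ (sym (∣1-x∣≡∣x-1∣ x)) (∣x-0∣≡∣x∣ x) (nearest false)))
    (∣1-x∣≡∣x-1∣ x)

  ∣2x-1∣≡∣gap∣ : ∀ x c →
    ∣ twoℚ * x - 1ℚ ∣ ≡ ∣ (x - bval (not c)) * (x - bval (not c)) - (x - bval c) * (x - bval c) ∣
  ∣2x-1∣≡∣gap∣ x false = trans
    (cong ∣_∣ (solve 1 (λ x → (con 1ℚ :+ con 1ℚ) :* x :- con 1ℚ
                           := :- ((x :- con 1ℚ) :* (x :- con 1ℚ) :- (x :- con 0ℚ) :* (x :- con 0ℚ))) refl x))
    (ℚP.∣-p∣≡∣p∣ _)
  ∣2x-1∣≡∣gap∣ x true = cong ∣_∣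
    (solve 1 (λ x → (con 1ℚ :+ con 1ℚ) :* x :- con 1ℚ
                  := (x :- con 0ℚ) :* (x :- con 0ℚ) :- (x :- con 1ℚ) :* (x :- con 1ℚ)) refl x)

  module _ {x : ℚ} {c : Bool} (nearest : IsNearestBit x c) where

    sqDist-nearest : (x - bval c) * (x - bval c) ≡ ⟨ x ⟩ * ⟨ x ⟩
    sqDist-nearest = sym (trans (cong (λ z → z * z) (⟨⟩-nearest {x} {c} nearest))
                                (∣p∣*∣p∣≡p*p (x - bval c)))

    sqDist-other : (x - bval (not c)) * (x - bval (not c)) ≡ ⟨ x ⟩ * ⟨ x ⟩ + ∣ twoℚ * x - 1ℚ ∣
    sqDist-other = begin
      q                    ≡⟨ solve 2 (λ p q → q := p :+ (q :- p)) refl p q ⟩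
      p + (q - p)          ≡⟨ cong₂ _+_ sqDist-nearest (sym (ℚP.0≤p⇒∣p∣≡p 0≤q-p)) ⟩
      ⟨ x ⟩ * ⟨ x ⟩ + ∣ q - p ∣ ≡⟨ cong (⟨ x ⟩ * ⟨ x ⟩ +_) (sym (∣2x-1∣≡∣gap∣ x c)) ⟩
      ⟨ x ⟩ * ⟨ x ⟩ + ∣ twoℚ * x - 1ℚ ∣ ∎
      where
      p q : ℚ
      p = (x - bval c) * (x - bval c)
      q = (x - bval (not c)) * (x - bval (not c))
      0≤q-p : 0ℚ ≤ q - p
      0≤q-p = p≤q⇒0≤q-p (∣p∣≤∣q∣⇒p*p≤q*q (nearest (not c)))

    sqDist-mismatch : ∀ g → (x - bval g) * (x - bval g) ≡ ⟨ x ⟩ * ⟨ x ⟩ + mismatch g c ∣ twoℚ * x - 1ℚ ∣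
    sqDist-mismatch g with g ≟ᵇ c
    ... | yes refl = trans sqDist-nearest (sym (ℚP.+-identityʳ _))
    ... | no g≢c rewrite ¬-not g≢c = sqDist-other

module SortedPrefixSums where

  open RationalSums
  open import Data.List using (List; []; _∷_; _++_; map; filter; take; length)
  import Data.List.Properties as List
  open import Data.List.Membership.Propositional.Properties using (∈-++⁻; ∈-∃++)
  open import Data.List.Relation.Unary.All as All using (All; _∷_)
  import Data.List.Relation.Unary.All.Properties as All
  open import Data.List.Relation.Unary.AllPairs using (AllPairs; _∷_)
  open import Data.List.Relation.Unary.Any using (here)
  open import Data.List.Relation.Binary.Permutation.Propositional using (_↭_; ↭-sym; ↭-trans; ↭ₛ⇒↭)
  import Data.List.Relation.Binary.Permutation.Propositional.Properties as ↭
  import Data.List.Relation.Binary.Permutation.Setoid.Properties as ↭ₛ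
  open import Data.List.Relation.Unary.Sorted.TotalOrder.Properties using (Sorted⇒AllPairs)
  open import Data.Nat as ℕ using (ℕ; zero; suc; _∸_; s≤s)
  import Data.Nat.Properties as ℕP
  open import Data.Product using (_,_)
  open import Data.Rational using (ℚ; 0ℚ; _+_; _≤_)
  import Data.Rational.Properties as ℚP
  open import Data.Rational.Solver using (module +-*-Solver)
  open +-*-Solver
  open import Data.List.Sort ℚP.≤-decTotalOrder using (sort; sort-↭; sort-↗)
  open import Data.Sum using (inj₁; inj₂)
  open import Relation.Binary.Bundles using (DecTotalOrder)
  open import Relation.Binary.PropositionalEquality
  open import Relation.Unary using (Decidable)
  open import Relation.Unary.Properties using (∁?)

  take-∷-min≤ : ∀ {x} {xs : List ℚ} k → All (x ≤_) xs → k ℕ.≤ length xs →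
    sumℚ (take k (x ∷ xs)) ≤ sumℚ (take k xs)
  take-∷-min≤ zero _ _ = ℚP.≤-refl
  take-∷-min≤ {xs = y ∷ _} (suc zero) (x≤y ∷ _) _ = ℚP.+-monoˡ-≤ 0ℚ x≤y
  take-∷-min≤ {x} {y ∷ xs} (suc (suc k)) (x≤y ∷ x≤xs) (s≤s k<len) =
    subst (_≤ y + sumℚ (take (suc k) xs))
      (solve 3 (λ x y t → y :+ (x :+ t) := x :+ (y :+ t)) refl x y (sumℚ (take k xs)))
      (ℚP.+-monoʳ-≤ y (take-∷-min≤ (suc k) x≤xs k<len))

  sorted-take≤sum : ∀ (xs us vs : List ℚ) → AllPairs _≤_ xs → xs ↭ us ++ vs →
    sumℚ (take (length us) xs) ≤ sumℚ us
  sorted-take≤sum [] [] vs _ _ = ℚP.≤-refl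
  sorted-take≤sum [] (_ ∷ _) vs _ p with ↭.↭-length p
  ... | ()
  sorted-take≤sum (x ∷ xs) us vs (x≤xs ∷ sorted) p with ∈-++⁻ us (↭.∈-resp-↭ p (here refl))
  ... | inj₁ x∈us with ∈-∃++ x∈us
  ...   | us₁ , us₂ , refl = subst₂ _≤_
          (cong (λ k → sumℚ (take k (x ∷ xs))) (sym (List.length-++-sucʳ us₁ x us₂)))
          (sym (sumℚ-↭ (↭.shift x us₁ us₂)))
          (ℚP.+-monoʳ-≤ x (sorted-take≤sum xs (us₁ ++ us₂) vs sorted xs↭))
    where
    xs↭ : xs ↭ (us₁ ++ us₂) ++ vs
    xs↭ = subst (xs ↭_) (sym (List.++-assoc us₁ us₂ vs))
      (↭.drop-mid [] us₁ (subst (x ∷ xs ↭_) (List.++-assoc us₁ (x ∷ us₂) vs) p))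
  sorted-take≤sum (x ∷ xs) us vs (x≤xs ∷ sorted) p | inj₂ x∈vs with ∈-∃++ x∈vs
  ...   | vs₁ , vs₂ , refl = ℚP.≤-trans (take-∷-min≤ (length us) x≤xs ∣us∣≤∣xs∣)
          (sorted-take≤sum xs us (vs₁ ++ vs₂) sorted xs↭)
    where
    xs↭ : xs ↭ us ++ (vs₁ ++ vs₂)
    xs↭ = subst (xs ↭_) (List.++-assoc us vs₁ vs₂)
      (↭.drop-mid [] (us ++ vs₁) (subst (x ∷ xs ↭_) (sym (List.++-assoc us vs₁ (x ∷ vs₂))) p))
    ∣us∣≤∣xs∣ : length us ℕ.≤ length xs
    ∣us∣≤∣xs∣ = subst (length us ℕ.≤_) (sym (trans (↭.↭-length xs↭) (List.length-++ us)))
      (ℕP.m≤m+n (length us) (length (vs₁ ++ vs₂)))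

  prefixSum-mono : ∀ {xs : List ℚ} → All (0ℚ ≤_) xs → ∀ {i j} → i ℕ.≤ j → prefixSum xs i ≤ prefixSum xs j
  prefixSum-mono {xs} 0≤xs {zero} {j} _ = sumℚ-nonNeg (All.take⁺ j 0≤xs)
  prefixSum-mono {[]} 0≤xs {suc i} {suc j} _ = ℚP.≤-refl
  prefixSum-mono {x ∷ xs} (_ ∷ 0≤xs) {suc i} {suc j} (s≤s i≤j) =
    ℚP.+-monoʳ-≤ x (prefixSum-mono 0≤xs i≤j)

  cutoff-maximal : ∀ {xs X s k} → IsCutoff xs X s → All (0ℚ ≤_) xs →
    k ℕ.≤ length xs → prefixSum xs k ≤ X → k ℕ.≤ s
  cutoff-maximal (_ , _ , X<next) 0≤xs k≤len sumₖ≤X = ℕP.≮⇒≥ λ s<k →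
    ℚP.<-irrefl refl (ℚP.<-≤-trans (X<next (ℕP.<-≤-trans s<k k≤len))
                                  (ℚP.≤-trans (prefixSum-mono 0≤xs s<k) sumₖ≤X))

  module _ {C : Set} {Q : C → Set} (Q? : Decidable Q) where

    filter-∁-↭ : (cs : List C) → cs ↭ filter (∁? Q?) cs ++ filter Q? cs
    filter-∁-↭ cs = ↭-trans
      (subst (λ (ys , zs) → cs ↭ ys ++ zs) (List.partition-defn Q? cs)
             (↭ₛ⇒↭ (↭ₛ.partition-↭ (setoid C) Q? cs)))
      (↭.++-comm (filter Q? cs) (filter (∁? Q?) cs))

    length∸cutoff≤length-filter : (b : C → ℚ) → (∀ c → 0ℚ ≤ b c) → (cs : List C) {Y : ℚ} {r : ℕ} →
      IsCutoff (sort (map b cs)) Y r → sumℚ (map b (filter (∁? Q?) cs)) ≤ Y →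
      length cs ∸ r ℕ.≤ length (filter Q? cs)
    length∸cutoff≤length-filter b 0≤b cs {r = r} cutoff sum≤Y =
      subst (length cs ∸ r ℕ.≤_) ∣cs∣∸∣N∣≡∣P∣ (ℕP.∸-monoʳ-≤ (length cs) ∣N∣≤r)
      where
      N P : List C
      N = filter (∁? Q?) cs
      P = filter Q? cs
      bs : List ℚ
      bs = sort (map b cs)
      ∣cs∣≡∣N∣+∣P∣ : length cs ≡ length N ℕ.+ length P
      ∣cs∣≡∣N∣+∣P∣ = trans (↭.↭-length (filter-∁-↭ cs)) (List.length-++ N)
      ∣cs∣∸∣N∣≡∣P∣ : length cs ∸ length N ≡ length P
      ∣cs∣∸∣N∣≡∣P∣ = trans (cong (_∸ length N) ∣cs∣≡∣N∣+∣P∣) (ℕP.m+n∸m≡n (length N) (length P))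
      bs↭ : bs ↭ map b N ++ map b P
      bs↭ = ↭-trans (sort-↭ (map b cs))
        (subst (map b cs ↭_) (List.map-++ b N P) (↭.map⁺ b (filter-∁-↭ cs)))
      ∣N∣≤∣bs∣ : length N ℕ.≤ length bs
      ∣N∣≤∣bs∣ = subst (length N ℕ.≤_)
        (sym (trans (↭.↭-length (sort-↭ (map b cs))) (trans (List.length-map b cs) ∣cs∣≡∣N∣+∣P∣)))
        (ℕP.m≤m+n (length N) (length P))
      ∣N∣≤r : length N ℕ.≤ r
      ∣N∣≤r = cutoff-maximal cutoff
        (↭.All-resp-↭ (↭-sym (sort-↭ (map b cs))) (All.map⁺ (All.universal 0≤b cs)))
        ∣N∣≤∣bs∣
        (ℚP.≤-trans
          (subst (λ k → prefixSum bs k ≤ sumℚ (map b N)) (List.length-map b N)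
            (sorted-take≤sum bs (map b N) (map b P)
              (Sorted⇒AllPairs (DecTotalOrder.totalOrder ℚP.≤-decTotalOrder) (sort-↗ (map b cs))) bs↭))
          sum≤Y)

open import Data.Nat using (ℕ; NonZero; _∸_; _≤_)
open import Data.Nat as ℕ using ()
open import Data.Rational using (ℚ; _-_; _+_; _*_)
open import Data.Rational as ℚ using ()
open import Data.List.Membership.Propositional using (_∈_)
open import Data.List using (List)
open import Data.Product using (_×_)

open import Data.Bool using (true; false)
open import Data.Fin using (Fin)
open import Data.List using ([]; _∷_; map; length; allFin; concatMap)
import Data.List.Properties as List
open import Data.Product using (_,_; uncurry)
import Data.Rational.Properties as ℚP
open import Data.Rational.Solver using (module +-*-Solver)
open +-*-Solver
open import Function using (id)
open import Relation.Binary.PropositionalEquality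
open ≡-Reasoning
open RationalSums
open Lines using (sumA≡lineSumTotal)
open Projection
open Mismatch
open NearestBit
open SortedPrefixSums

length-cells : ∀ m n → length (cells m n) ≡ m ℕ.* n
length-cells m n = trans (length-rows (allFin m)) (cong (ℕ._* n) (List.length-tabulate {n = m} id))
  where
  length-rows : (is : List (Fin m)) → length (concatMap (λ i → map (i ,_) (allFin n)) is) ≡ length is ℕ.* n
  length-rows []       = refl
  length-rows (i ∷ is) = trans (List.length-++ (map (i ,_) (allFin n)))
    (cong₂ ℕ._+_ (trans (List.length-map (i ,_) (allFin n)) (List.length-tabulate {n = n} id)) (length-rows is))

roundingGap : {m n : ℕ} → Fun m n → Fin m × Fin n → ℚ
roundingGap f c = ℚ.∣ twoℚ * uncurry f c - ℚ.1ℚ ∣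

bval*bval≡bval : ∀ g → bval g * bval g ≡ bval g
bval*bval≡bval true  = refl
bval*bval≡bval false = refl

normSq-B01 : {m n : ℕ} (g : B01 m n) → normSq (asFun g) ≡ sumA (asFun g)
normSq-B01 {m} {n} g = sumA-cong {m} {n} (λ i j → bval*bval≡bval (g i j))

module _ {m n : ℕ} {S : List Direction} {h f₀ : Fun m n} (proj : IsProjection S h f₀)
         {d₀ : Direction} (d₀∈S : d₀ ∈ S) {F : B01 m n} (rounding : IsRounding f₀ F) where

  disagreementWeight-rounding : (g : B01 m n) → SameLineSums S (asFun g) h →
    disagreementWeight (roundingGap f₀) (uncurry g) (uncurry F) (cells m n)
      ≡ lineSumTotal h d₀ - Equant f₀ - normSq f₀
  disagreementWeight-rounding g g~h = begin
    disagreementWeight (roundingGap f₀) (uncurry g) (uncurry F) cs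
      ≡⟨ disagreementWeight≡sum-mismatch (roundingGap f₀) (uncurry g) (uncurry F) cs ⟩
    W
      ≡⟨ solve 2 (λ e w → w := (e :+ w) :- e) refl (Equant f₀) W ⟩
    (Equant f₀ + W) - Equant f₀
      ≡⟨ cong (_- Equant f₀) (sym normSq-split) ⟩
    normSq (f₀ -ᶠ asFun g) - Equant f₀
      ≡⟨ cong (_- Equant f₀) (pythagoras proj g~h) ⟩
    (normSq (asFun g) - normSq f₀) - Equant f₀
      ≡⟨ cong (λ z → (z - normSq f₀) - Equant f₀)
              (trans (normSq-B01 g) (sumA≡lineSumTotal (asFun g) h d₀ (g~h d₀ d₀∈S))) ⟩
    (lineSumTotal h d₀ - normSq f₀) - Equant f₀
      ≡⟨ solve 3 (λ d nn e → (d :- nn) :- e := (d :- e) :- nn) refl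
                 (lineSumTotal h d₀) (normSq f₀) (Equant f₀) ⟩
    lineSumTotal h d₀ - Equant f₀ - normSq f₀
      ∎
    where
    cs : List (Fin m × Fin n)
    cs = cells m n
    W : ℚ
    W = sumℚ (map (λ c → mismatch (uncurry g c) (uncurry F c) (roundingGap f₀ c)) cs)
    normSq-split : normSq (f₀ -ᶠ asFun g) ≡ Equant f₀ + W
    normSq-split = trans
      (sumℚ-map-cong (λ (i , j) → sqDist-mismatch {f₀ i j} {F i j} (rounding i j) (g i j)) cs)
      (sumℚ-map-+ _ _ cs)

agreements≥ : {m n : ℕ} (f₀ : Fun m n) (g g′ : B01 m n) {Y : ℚ} {r : ℕ} →
  IsCutoff (bList f₀) Y r →
  disagreementWeight (roundingGap f₀) (uncurry g) (uncurry g′) (cells m n) ℚ.≤ Y →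
  m ℕ.* n ∸ r ≤ agreements g g′
agreements≥ {m} {n} f₀ g g′ {r = r} cutoff weight≤Y =
  subst (λ k → k ∸ r ≤ agreements g g′) (length-cells m n)
    (length∸cutoff≤length-filter (agree? (uncurry g) (uncurry g′)) (roundingGap f₀)
      (λ c → ℚP.0≤∣p∣ _) (cells m n) cutoff weight≤Y)

theorem4p2 : (m n : ℕ) → .{{_ : NonZero m}} → .{{_ : NonZero n}}
    → (S : List Direction) → ValidDirs m n S
    → (h : Fun m n)
    → (f₀ : Fun m n) → IsProjection S h f₀
    → (d₀ : Direction) → d₀ ∈ S
    → (F : B01 m n) → IsRounding f₀ F
    → (s t : ℕ)
    → IsCutoff (bList f₀) (lineSumTotal h d₀ - Equant f₀ - normSq f₀) s
    → IsCutoff (bList f₀) (twoℚ * (lineSumTotal h d₀ - Equant f₀ - normSq f₀)) t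
    → ((g : B01 m n) → SameLineSums S (asFun g) h → m ℕ.* n ∸ s ≤ agreements g F)
      × ((g₁ g₂ : B01 m n) → SameLineSums S (asFun g₁) h → SameLineSums S (asFun g₂) h
           → m ℕ.* n ∸ t ≤ agreements g₁ g₂)
theorem4p2 m n S _ h f₀ proj d₀ d₀∈S F rounding s t cutₛ cutₜ = part-a , part-b
  where
  X : ℚ
  X = lineSumTotal h d₀ - Equant f₀ - normSq f₀
  weight≡X : (g : B01 m n) → SameLineSums S (asFun g) h →
    disagreementWeight (roundingGap f₀) (uncurry g) (uncurry F) (cells m n) ≡ X
  weight≡X = disagreementWeight-rounding proj d₀∈S rounding
  part-a : (g : B01 m n) → SameLineSums S (asFun g) h → m ℕ.* n ∸ s ≤ agreements g F
  part-a g g~h = agreements≥ f₀ g F cutₛ (ℚP.≤-reflexive (weight≡X g g~h))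
  part-b : (g₁ g₂ : B01 m n) → SameLineSums S (asFun g₁) h → SameLineSums S (asFun g₂) h
           → m ℕ.* n ∸ t ≤ agreements g₁ g₂
  part-b g₁ g₂ g₁~h g₂~h = agreements≥ f₀ g₁ g₂ cutₜ (ℚP.≤-trans
    (disagreementWeight-triangle (roundingGap f₀) (λ c → ℚP.0≤∣p∣ _)
                                 (uncurry g₁) (uncurry g₂) (uncurry F) (cells m n))
    (ℚP.≤-reflexive (trans (cong₂ _+_ (weight≡X g₁ g₁~h) (weight≡X g₂ g₂~h))
                           (solve 1 (λ x → x :+ x := (con ℚ.1ℚ :+ con ℚ.1ℚ) :* x) refl X))))
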